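{- Let $G$ and $H$ be finite graphs with adjacency matrices $A=A_G$ and $B=A_H$, and let $M$ be a nonnegative real $|V(G)|\times|V(H)|$ matrix such that $MM^{\mathsf T}$ and $M^{\mathsf T}M$ are doubly stochastic and $AM=MB$. Let $\pi$ be the partition of $V(G)$ into the classes of the relation $a\sim b \iff ((MM^{\mathsf T})^{\ell})_{a,b}\neq 0$ for some integer $\ell\ge 0$, and let $\sigma$ be the partition of $V(H)$ defined in the same way from $M^{\mathsf T}M$; say $\pi$ has $k$ cells. Let $Z_M$ be the graph on vertex set $V(G)\sqcup V(H)$ whose adjacency matrix is the support (zero/nonzero pattern) of $\begin{pmatrix}0&M\\ M^{\mathsf T}&0\end{pmatrix}$. Then $Z_M$ is a bipartite graph with exactly $k$ connected components, and the vertex set of each component is of the form $C\cup D$ with $C$ a cell of $\pi$ and $D$ a cell of $\sigma$, each cell of $\pi$ and each cell of $\sigma$occurring in exactly one component.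
   Context: Graphs are finite, simple and undirected; $A_G$ denotes the adjacency matrix indexed by $V(G)$. A real matrix is doubly stochastic if it is square, nonnegative, and all its row and column sums equal $1$. (Under these hypotheses the relation $\sim$ above is an equivalence relation, and $\pi$, $\sigma$ are equitable partitions of $G$ and $H$ respectively.) -}

module Defs where

open import Level using (0ℓ)
open import Data.Nat using (ℕ; zero; suc)
open import Data.Fin using (Fin; zero; suc)
open import Data.Bool using (Bool; true; false; if_then_else_)
open import Data.Sum using (_⊎_; inj₁; inj₂)
open import Data.Product using (Σ; ∃; ∃-syntax; _×_; _,_)
open import Data.Empty using (⊥)
open import Relation.Nullary using (¬_)
open import Relation.Binary.PropositionalEquality using (_≡_; _≢_)
open import Relation.Binary.Structures using (IsTotalOrder)
open import Algebra.Structures using (IsCommutativeRing)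
open import Relation.Binary.Construct.Closure.ReflexiveTransitive using (Star)
open import Function.Bundles using (_⇔_)

-- The real numbers, axiomatised as a complete ordered field
-- (any such structure is isomorphic to ℝ).

record CompleteOrderedField : Set₁ where
  infixl 6 _+_
  infixl 7 _*_
  infix 4 _≤_
  field
    Carrier : Set
    _+_ _*_ : Carrier → Carrier → Carrier
    -_      : Carrier → Carrier
    0# 1#   : Carrier
    _≤_     : Carrier → Carrier → Set
    isCommutativeRing : IsCommutativeRing _≡_ _+_ _*_ -_ 0# 1#
    0≢1     : 0# ≢ 1#
    inverse : ∀ x → x ≢ 0# → ∃[ y ] (x * y ≡ 1#)
    isTotalOrder : IsTotalOrder _≡_ _≤_
    +-mono  : ∀ x y z → x ≤ y → x + z ≤ y + z
    *-nonneg : ∀ x y → 0# ≤ x → 0# ≤ y → 0# ≤ x * y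
    lub : (P : Carrier → Set) → (∃[ x ] P x) → (∃[ u ] (∀ x → P x → x ≤ u)) →
          ∃[ s ] ((∀ x → P x → x ≤ s) × (∀ u → (∀ x → P x → x ≤ u) → s ≤ u))

record Graph (n : ℕ) : Set where
  field
    adj   : Fin n → Fin n → Bool
    sym   : ∀ i j → adj i j ≡ adj j i
    irrefl : ∀ i → adj i i ≡ false

NumClasses : {X : Set} → (X → X → Set) → ℕ → Set
NumClasses {X} R k =
  Σ (Fin k → X) λ r →
    (∀ i j → R (r i) (r j) → i ≡ j) × (∀ x → ∃[ i ] R (r i) x)

module Mat (R : CompleteOrderedField) where
  open CompleteOrderedField R

  Matrix : ℕ → ℕ → Set
  Matrix m n = Fin m → Fin n → Carrier

  Σᶠ : (n : ℕ) → (Fin n → Carrier) → Carrier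
  Σᶠ zero    f = 0#
  Σᶠ (suc n) f = f zero + Σᶠ n (λ i → f (suc i))

  _ᵀ : ∀ {m n} → Matrix m n → Matrix n m
  (M ᵀ) i j = M j i

  _·_ : ∀ {m n p} → Matrix m n → Matrix n p → Matrix m p
  _·_ {n = n} M N i j = Σᶠ n (λ l → M i l * N l j)

  I : ∀ {n} → Matrix n n
  I zero    zero    = 1#
  I zero    (suc j) = 0#
  I (suc i) zero    = 0#
  I (suc i) (suc j) = I i j

  _^ᴹ_ : ∀ {n} → Matrix n n → ℕ → Matrix n n
  M ^ᴹ zero  = I
  M ^ᴹ suc ℓ = M · (M ^ᴹ ℓ)

  Nonneg : ∀ {m n} → Matrix m n → Set
  Nonneg M = ∀ i j → 0# ≤ M i j

  DoublyStochastic : ∀ {n} → Matrix n n → Set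
  DoublyStochastic {n} M =
    Nonneg M × (∀ i → Σᶠ n (λ j → M i j) ≡ 1#) × (∀ j → Σᶠ n (λ i → M i j) ≡ 1#)

  adjMatrix : ∀ {n} → Graph n → Matrix n n
  adjMatrix G i j = if Graph.adj G i j then 1# else 0#

  Reach : ∀ {n} → Matrix n n → Fin n → Fin n → Set
  Reach P a b = ∃[ ℓ ] ((P ^ᴹ ℓ) a b ≢ 0#)

  ZAdj : ∀ {m n} → Matrix m n → (Fin m ⊎ Fin n) → (Fin m ⊎ Fin n) → Set
  ZAdj M (inj₁ a) (inj₁ a') = ⊥
  ZAdj M (inj₁ a) (inj₂ b)  = M a b ≢ 0#
  ZAdj M (inj₂ b) (inj₁ a)  = M a b ≢ 0#
  ZAdj M (inj₂ b) (inj₂ b') = ⊥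

  ZConn : ∀ {m n} → Matrix m n → (Fin m ⊎ Fin n) → (Fin m ⊎ Fin n) → Set
  ZConn M = Star (ZAdj M)

  IsBipartite : {V : Set} → (V → V → Set) → Set
  IsBipartite {V} E = Σ (V → Bool) λ c → ∀ u v → E u v → ¬ (c u ≡ c v)

-- Since M ≥ 0 no cancellation can occur, so a walk a = a₀, b₁, a₁, …, bℓ, aℓ = a' in Z_M
-- exists exactly when ((MMᵀ)^ℓ)_{a a'} ≠ 0; thus the Z_M-components restricted to V(G)
-- are the cells of π, and likewise for V(H) and σ. Row sums of MMᵀ and MᵀM equal to 1
-- give every vertex a neighbour on the other side, so every component meets both sides.
-- Constructively, extracting a nonzero summand from a nonzero sum needs a weak form of
-- excluded middle, which the least-upper-bound axiom supplies.
module Submission where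

open import Defs
open import Level using (0ℓ)
open import Data.Nat using (ℕ; zero; suc)
open import Data.Fin using (Fin; zero; suc)
open import Data.Bool using (Bool; true; false)
open import Data.Empty using (⊥-elim)
open import Data.Sum using (_⊎_; inj₁; inj₂; swap)
open import Data.Product using (∃; ∃-syntax; _×_; _,_; proj₁; proj₂)
open import Function.Bundles using (_⇔_; mk⇔; module Equivalence)
open import Function.Construct.Composition using (_⇔-∘_)
open import Relation.Nullary using (¬_)
open import Relation.Binary.PropositionalEquality using (_≡_; _≢_; refl; sym; trans; cong; cong₂; subst; subst₂; module ≡-Reasoning)
open import Relation.Binary.Construct.Closure.ReflexiveTransitive using (ε; _◅_; _◅◅_; gmap; reverse)
open import Relation.Binary.Structures using (IsTotalOrder)
open import Algebra.Bundles using (Ring)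
open import Algebra.Structures using (IsCommutativeRing)
import Algebra.Properties.Ring as RingProperties

module OrderedFieldProperties (R : CompleteOrderedField) where
  open CompleteOrderedField R
  open IsCommutativeRing isCommutativeRing
    using (isRing; +-identityˡ; +-identityʳ; +-assoc; +-comm; -‿inverseʳ; distribʳ; *-identityˡ; *-assoc; *-comm; zeroˡ; zeroʳ)
  open IsTotalOrder isTotalOrder using (total; antisym) renaming (trans to ≤-trans; reflexive to ≤-reflexive)

  ring : Ring 0ℓ 0ℓ
  ring = record
    { Carrier = Carrier ; _≈_ = _≡_ ; _+_ = _+_ ; _*_ = _*_ ; -_ = -_ ; 0# = 0# ; 1# = 1# ; isRing = isRing }

  open RingProperties ring using (-1*x≈-x; -‿involutive)

  ≤-refl : ∀ {x} → x ≤ x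
  ≤-refl = ≤-reflexive refl

  +-monoˡ-≤ : ∀ z {x y} → x ≤ y → x + z ≤ y + z
  +-monoˡ-≤ z {x} {y} = +-mono x y z

  +-monoʳ-≤ : ∀ z {x y} → x ≤ y → z + x ≤ z + y
  +-monoʳ-≤ z {x} {y} x≤y = subst₂ _≤_ (+-comm x z) (+-comm y z) (+-mono x y z x≤y)

  +-mono-≤ : ∀ {x y u v} → x ≤ y → u ≤ v → x + u ≤ y + v
  +-mono-≤ x≤y u≤v = ≤-trans (+-monoˡ-≤ _ x≤y) (+-monoʳ-≤ _ u≤v)

  +-cancelʳ-≤ : ∀ z {x y} → x + z ≤ y + z → x ≤ y
  +-cancelʳ-≤ z {x} {y} le = subst₂ _≤_ (x+z-z≡x x) (x+z-z≡x y) (+-monoˡ-≤ (- z) le)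
    where
    x+z-z≡x : ∀ x → x + z + - z ≡ x
    x+z-z≡x x = trans (+-assoc x z (- z)) (trans (cong (x +_) (-‿inverseʳ z)) (+-identityʳ x))

  -1*-1≡1 : (- 1#) * (- 1#) ≡ 1#
  -1*-1≡1 = trans (-1*x≈-x (- 1#)) (-‿involutive 1#)

  0≤1 : 0# ≤ 1#
  0≤1 with total 0# 1#
  ... | inj₁ 0≤1 = 0≤1
  ... | inj₂ 1≤0 = subst (0# ≤_) -1*-1≡1 (*-nonneg _ _ 0≤-1 0≤-1)
    where
    0≤-1 : 0# ≤ - 1#
    0≤-1 = subst₂ _≤_ (-‿inverseʳ 1#) (+-identityˡ (- 1#)) (+-monoˡ-≤ (- 1#) 1≤0)

  1≰0 : ¬ (1# ≤ 0#)
  1≰0 1≤0 = 0≢1 (antisym 0≤1 1≤0)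

  ≡1⇒≢0 : ∀ {x} → x ≡ 1# → x ≢ 0#
  ≡1⇒≢0 x≡1 x≡0 = 0≢1 (trans (sym x≡0) x≡1)

  x≤x+y : ∀ x {y} → 0# ≤ y → x ≤ x + y
  x≤x+y x {y} 0≤y = subst (_≤ x + y) (+-identityʳ x) (+-monoʳ-≤ x 0≤y)

  +-nonneg : ∀ {x y} → 0# ≤ x → 0# ≤ y → 0# ≤ x + y
  +-nonneg 0≤x 0≤y = subst (_≤ _) (+-identityˡ 0#) (+-mono-≤ 0≤x 0≤y)

  +-nonneg-≡0ˡ : ∀ {x y} → 0# ≤ x → 0# ≤ y → x + y ≡ 0# → x ≡ 0#
  +-nonneg-≡0ˡ {x} 0≤x 0≤y x+y≡0 = antisym (subst (x ≤_) x+y≡0 (x≤x+y x 0≤y)) 0≤x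

  +-nonneg-≡0ʳ : ∀ {x y} → 0# ≤ x → 0# ≤ y → x + y ≡ 0# → y ≡ 0#
  +-nonneg-≡0ʳ {x} {y} 0≤x 0≤y x+y≡0 = +-nonneg-≡0ˡ 0≤y 0≤x (trans (+-comm y x) x+y≡0)

  *-≢0 : ∀ {x y} → x ≢ 0# → y ≢ 0# → x * y ≢ 0#
  *-≢0 {x} {y} x≢0 y≢0 xy≡0 with inverse x x≢0
  ... | u , xu≡1 = y≢0 (begin
    y             ≡⟨ sym (*-identityˡ y) ⟩
    1# * y        ≡⟨ cong (_* y) (trans (sym xu≡1) (*-comm x u)) ⟩
    (u * x) * y   ≡⟨ *-assoc u x y ⟩
    u * (x * y)   ≡⟨ cong (u *_) xy≡0 ⟩
    u * 0#        ≡⟨ zeroʳ u ⟩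
    0#            ∎)
    where open ≡-Reasoning

  *-≢0ˡ : ∀ {x y} → x * y ≢ 0# → x ≢ 0#
  *-≢0ˡ {y = y} xy≢0 x≡0 = xy≢0 (trans (cong (_* y) x≡0) (zeroˡ y))

  *-≢0ʳ : ∀ {x y} → x * y ≢ 0# → y ≢ 0#
  *-≢0ʳ {x = x} xy≢0 y≡0 = xy≢0 (trans (cong (x *_) y≡0) (zeroʳ x))

  half : ∃[ h ] (h + h ≡ 1#)
  half with inverse (1# + 1#) (λ 1+1≡0 → 1≰0 (subst (1# ≤_) 1+1≡0 (x≤x+y 1# 0≤1)))
  ... | h , 2h≡1 = h , trans (sym (distribʳ-1 h)) 2h≡1
    where
    distribʳ-1 : ∀ h → (1# + 1#) * h ≡ h + h
    distribʳ-1 h = trans (distribʳ h 1# 1#) (cong₂ _+_ (*-identityˡ h) (*-identityˡ h))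

  half-strictly-between : ∀ h → h + h ≡ 1# → ¬ (h ≤ 0#) × ¬ (1# ≤ h)
  half-strictly-between h h+h≡1 =
    (λ h≤0 → 1≰0 (subst₂ _≤_ h+h≡1 (+-identityˡ 0#) (+-mono-≤ h≤0 h≤0))) ,
    (λ 1≤h → 1≰0 (+-cancelʳ-≤ 1# (subst₂ _≤_ refl (trans h+h≡1 (sym (+-identityˡ 1#))) (+-mono-≤ 1≤h 1≤h))))

  -- Compare the supremum s of {0} ∪ {1 ∣ Q} with ½: if s ≤ ½ then Q fails, and if
  -- ½ ≤ s then Q cannot fail, since otherwise s = 0.
  weak-excluded-middle : (Q : Set) → ¬ Q ⊎ ¬ ¬ Q
  weak-excluded-middle Q with half | lub P (0# , inj₁ refl) (1# , P≤1)
    where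
    P : Carrier → Set
    P x = (x ≡ 0#) ⊎ (Q × x ≡ 1#)
    P≤1 : ∀ x → P x → x ≤ 1#
    P≤1 x (inj₁ refl) = 0≤1
    P≤1 x (inj₂ (_ , refl)) = ≤-refl
  ... | h , h+h≡1 | s , s-upper , s-least with total s h
  ... | inj₁ s≤h = inj₁ λ q → proj₂ (half-strictly-between h h+h≡1) (≤-trans (s-upper 1# (inj₂ (q , refl))) s≤h)
  ... | inj₂ h≤s = inj₂ λ ¬q → proj₁ (half-strictly-between h h+h≡1) (≤-trans h≤s (s-least 0# λ
         { _ (inj₁ refl) → ≤-refl ; _ (inj₂ (q , _)) → ⊥-elim (¬q q) }))

  open Mat R

  Σᶠ-nonneg : ∀ n (f : Fin n → Carrier) → (∀ i → 0# ≤ f i) → 0# ≤ Σᶠ n f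
  Σᶠ-nonneg zero    f f≥0 = ≤-refl
  Σᶠ-nonneg (suc n) f f≥0 = +-nonneg (f≥0 zero) (Σᶠ-nonneg n (λ i → f (suc i)) (λ i → f≥0 (suc i)))

  Σᶠ-nonneg-≡0 : ∀ n (f : Fin n → Carrier) → (∀ i → 0# ≤ f i) → Σᶠ n f ≡ 0# → ∀ i → f i ≡ 0#
  Σᶠ-nonneg-≡0 (suc n) f f≥0 Σ≡0 zero = +-nonneg-≡0ˡ (f≥0 zero) (Σᶠ-nonneg n _ (λ i → f≥0 (suc i))) Σ≡0
  Σᶠ-nonneg-≡0 (suc n) f f≥0 Σ≡0 (suc i) =
    Σᶠ-nonneg-≡0 n (λ i → f (suc i)) (λ i → f≥0 (suc i)) (+-nonneg-≡0ʳ (f≥0 zero) (Σᶠ-nonneg n _ (λ i → f≥0 (suc i))) Σ≡0) i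

  Σᶠ-≢0⇒∃≢0 : ∀ n (f : Fin n → Carrier) → Σᶠ n f ≢ 0# → ∃[ i ] (f i ≢ 0#)
  Σᶠ-≢0⇒∃≢0 zero    f Σ≢0 = ⊥-elim (Σ≢0 refl)
  Σᶠ-≢0⇒∃≢0 (suc n) f Σ≢0 with weak-excluded-middle (f zero ≡ 0#)
  ... | inj₁ f₀≢0 = zero , f₀≢0
  ... | inj₂ ¬f₀≢0 with Σᶠ-≢0⇒∃≢0 n (λ i → f (suc i)) rest≢0
    where
    rest≢0 : Σᶠ n (λ i → f (suc i)) ≢ 0#
    rest≢0 rest≡0 = ¬f₀≢0 λ f₀≡0 → Σ≢0 (trans (cong₂ _+_ f₀≡0 rest≡0) (+-identityˡ 0#))
  ... | i , fᵢ≢0 = suc i , fᵢ≢0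

  ·-nonneg : ∀ {m n p} {A : Matrix m n} {B : Matrix n p} → Nonneg A → Nonneg B → Nonneg (A · B)
  ·-nonneg {n = n} A≥0 B≥0 i j = Σᶠ-nonneg n _ (λ l → *-nonneg _ _ (A≥0 i l) (B≥0 l j))

  I-nonneg : ∀ {n} → Nonneg (I {n})
  I-nonneg zero    zero    = 0≤1
  I-nonneg zero    (suc j) = ≤-refl
  I-nonneg (suc i) zero    = ≤-refl
  I-nonneg (suc i) (suc j) = I-nonneg i j

  ^ᴹ-nonneg : ∀ {n} {P : Matrix n n} → Nonneg P → ∀ ℓ → Nonneg (P ^ᴹ ℓ)
  ^ᴹ-nonneg P≥0 zero    = I-nonneg
  ^ᴹ-nonneg P≥0 (suc ℓ) = ·-nonneg P≥0 (^ᴹ-nonneg P≥0 ℓ)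

  ·-≢0 : ∀ {m n p} {A : Matrix m n} {B : Matrix n p} → Nonneg A → Nonneg B →
         ∀ {i l j} → A i l ≢ 0# → B l j ≢ 0# → (A · B) i j ≢ 0#
  ·-≢0 {n = n} A≥0 B≥0 {i} {l} {j} Ail≢0 Blj≢0 AB≡0 =
    *-≢0 Ail≢0 Blj≢0 (Σᶠ-nonneg-≡0 n _ (λ l → *-nonneg _ _ (A≥0 i l) (B≥0 l j)) AB≡0 l)

  ·-≢0⇒∃ : ∀ {m n p} (A : Matrix m n) (B : Matrix n p) {i j} →
           (A · B) i j ≢ 0# → ∃[ l ] (A i l ≢ 0# × B l j ≢ 0#)
  ·-≢0⇒∃ {n = n} A B AB≢0 with Σᶠ-≢0⇒∃≢0 n _ AB≢0
  ... | l , AB≢0ₗ = l , *-≢0ˡ AB≢0ₗ , *-≢0ʳ AB≢0ₗ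

  I-≢0⇒≡ : ∀ {n} (i j : Fin n) → I i j ≢ 0# → i ≡ j
  I-≢0⇒≡ zero    zero    _   = refl
  I-≢0⇒≡ zero    (suc j) I≢0 = ⊥-elim (I≢0 refl)
  I-≢0⇒≡ (suc i) zero    I≢0 = ⊥-elim (I≢0 refl)
  I-≢0⇒≡ (suc i) (suc j) I≢0 = cong suc (I-≢0⇒≡ i j I≢0)

  I-diagonal-≢0 : ∀ {n} (i : Fin n) → I i i ≢ 0#
  I-diagonal-≢0 zero    = λ 1≡0 → 0≢1 (sym 1≡0)
  I-diagonal-≢0 (suc i) = I-diagonal-≢0 i

  Reach-refl : ∀ {n} (P : Matrix n n) a → Reach P a a
  Reach-refl P a = zero , I-diagonal-≢0 a

  stochastic-row-support : ∀ {n m} (N : Matrix n m) → DoublyStochastic (N · (N ᵀ)) → ∀ a → ∃[ b ] (N a b ≢ 0#)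
  stochastic-row-support {n} N (_ , rows , _) a with Σᶠ-≢0⇒∃≢0 n _ (≡1⇒≢0 (rows a))
  ... | a' , NNᵀ≢0 with ·-≢0⇒∃ N (N ᵀ) NNᵀ≢0
  ... | b , Nab≢0 , _ = b , Nab≢0

  ZAdj-bipartite : ∀ {n m} (N : Matrix n m) → IsBipartite (ZAdj N)
  ZAdj-bipartite N = side , λ
    { (inj₁ _) (inj₂ _) _ () ; (inj₂ _) (inj₁ _) _ () ; (inj₁ _) (inj₁ _) () ; (inj₂ _) (inj₂ _) () }
    where
    side : Fin _ ⊎ Fin _ → Bool
    side (inj₁ _) = true
    side (inj₂ _) = false

  ZAdj-sym : ∀ {n m} (N : Matrix n m) x y → ZAdj N x y → ZAdj N y x
  ZAdj-sym N (inj₁ _) (inj₂ _) e = e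
  ZAdj-sym N (inj₂ _) (inj₁ _) e = e

  ZConn-sym : ∀ {n m} (N : Matrix n m) {x y} → ZConn N x y → ZConn N y x
  ZConn-sym N = reverse (ZAdj-sym N _ _)

  ZConn-source : ∀ {n m} (N : Matrix n m) {v w x} → ZConn N v w → ZConn N v x ⇔ ZConn N w x
  ZConn-source N v~w = mk⇔ (ZConn-sym N v~w ◅◅_) (v~w ◅◅_)

  same-component : ∀ {n m} (N : Matrix n m) {v w x} → ZConn N v x → ZConn N w x → ZConn N v w
  same-component N v~x w~x = v~x ◅◅ ZConn-sym N w~x

  ZAdj-ᵀ : ∀ {n m} (N : Matrix n m) x y → ZAdj N x y → ZAdj (N ᵀ) (swap x) (swap y)
  ZAdj-ᵀ N (inj₁ _) (inj₂ _) e = e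
  ZAdj-ᵀ N (inj₂ _) (inj₁ _) e = e

  ZConn-ᵀ : ∀ {n m} (N : Matrix n m) {x y} → ZConn N x y → ZConn (N ᵀ) (swap x) (swap y)
  ZConn-ᵀ N = gmap swap (ZAdj-ᵀ N _ _)

  module _ {n m} (N : Matrix n m) (N≥0 : Nonneg N) where

    NNᵀ-nonneg : Nonneg (N · (N ᵀ))
    NNᵀ-nonneg = ·-nonneg N≥0 (λ i j → N≥0 j i)

    walk⇒Reach : ∀ {a a'} → ZConn N (inj₁ a) (inj₁ a') → Reach (N · (N ᵀ)) a a'
    walk⇒Reach {a} ε = Reach-refl _ a
    walk⇒Reach (_◅_ {j = inj₂ b} Nab≢0 (_◅_ {j = inj₁ l} Nlb≢0 walk)) with walk⇒Reach walk
    ... | ℓ , Pℓ≢0 = suc ℓ , ·-≢0 NNᵀ-nonneg (^ᴹ-nonneg NNᵀ-nonneg ℓ)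
                               (·-≢0 N≥0 (λ i j → N≥0 j i) Nab≢0 Nlb≢0) Pℓ≢0

    Reach⇒walk : ∀ ℓ a a' → ((N · (N ᵀ)) ^ᴹ ℓ) a a' ≢ 0# → ZConn N (inj₁ a) (inj₁ a')
    Reach⇒walk zero a a' I≢0 with I-≢0⇒≡ a a' I≢0
    ... | refl = ε
    Reach⇒walk (suc ℓ) a a' Pℓ⁺¹≢0 with ·-≢0⇒∃ (N · (N ᵀ)) ((N · (N ᵀ)) ^ᴹ ℓ) Pℓ⁺¹≢0
    ... | l , P≢0 , Pℓ≢0 with ·-≢0⇒∃ N (N ᵀ) P≢0
    ... | b , Nab≢0 , Nlb≢0 = _◅_ {j = inj₂ b} Nab≢0 (Nlb≢0 ◅ Reach⇒walk ℓ l a' Pℓ≢0)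

    ZConn⇔Reach : ∀ a a' → ZConn N (inj₁ a) (inj₁ a') ⇔ Reach (N · (N ᵀ)) a a'
    ZConn⇔Reach a a' = mk⇔ walk⇒Reach (λ { (ℓ , Pℓ≢0) → Reach⇒walk ℓ a a' Pℓ≢0 })

  module Components {n m} (M : Matrix n m) (M≥0 : Nonneg M)
                    (MMᵀ-ds : DoublyStochastic (M · (M ᵀ))) (MᵀM-ds : DoublyStochastic ((M ᵀ) · M)) where
    open Equivalence

    ZConn⇔Reachᴳ : ∀ a a' → ZConn M (inj₁ a) (inj₁ a') ⇔ Reach (M · (M ᵀ)) a a'
    ZConn⇔Reachᴳ = ZConn⇔Reach M M≥0

    ZConn⇔Reachᴴ : ∀ b b' → ZConn M (inj₂ b) (inj₂ b') ⇔ Reach ((M ᵀ) · M) b b'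
    ZConn⇔Reachᴴ b b' = mk⇔ (λ walk → to (ZConn⇔Reachᵀ b b') (ZConn-ᵀ M walk))
                            (λ r → ZConn-ᵀ (M ᵀ) (from (ZConn⇔Reachᵀ b b') r))
      where
      ZConn⇔Reachᵀ : ∀ b b' → ZConn (M ᵀ) (inj₁ b) (inj₁ b') ⇔ Reach ((M ᵀ) · M) b b'
      ZConn⇔Reachᵀ = ZConn⇔Reach (M ᵀ) (λ i j → M≥0 j i)

    G-vertex-in-component : ∀ v → ∃[ a ] ZConn M v (inj₁ a)
    G-vertex-in-component (inj₁ a) = a , ε
    G-vertex-in-component (inj₂ b) with stochastic-row-support (M ᵀ) MᵀM-ds b
    ... | a , Mab≢0 = a , Mab≢0 ◅ ε

    H-vertex-in-component : ∀ v → ∃[ b ] ZConn M v (inj₂ b)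
    H-vertex-in-component (inj₂ b) = b , ε
    H-vertex-in-component (inj₁ a) with stochastic-row-support M MMᵀ-ds a
    ... | b , Mab≢0 = b , Mab≢0 ◅ ε

    ZConn-numClasses : ∀ k → NumClasses (Reach (M · (M ᵀ))) k → NumClasses (ZConn M) k
    ZConn-numClasses k (r , r-distinct , r-cover) =
      (λ i → inj₁ (r i)) , (λ i j walk → r-distinct i j (to (ZConn⇔Reachᴳ _ _) walk)) , cover
      where
      cover : ∀ v → ∃[ i ] ZConn M (inj₁ (r i)) v
      cover v with G-vertex-in-component v
      ... | a , v~a with r-cover a
      ... | i , rᵢ~a = i , (from (ZConn⇔Reachᴳ _ _) rᵢ~a ◅◅ ZConn-sym M v~a)

    component-cells : ∀ v → ∃[ a ] ∃[ b ]
      ((∀ a' → ZConn M v (inj₁ a') ⇔ Reach (M · (M ᵀ)) a a')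
       × (∀ b' → ZConn M v (inj₂ b') ⇔ Reach ((M ᵀ) · M) b b'))
    component-cells v with G-vertex-in-component v | H-vertex-in-component v
    ... | a , v~a | b , v~b =
      a , b , (λ a' → ZConn⇔Reachᴳ a a' ⇔-∘ ZConn-source M v~a)
            , (λ b' → ZConn⇔Reachᴴ b b' ⇔-∘ ZConn-source M v~b)

corollary9 : (R : CompleteOrderedField) → let open Mat R in
    ∀ (n m : ℕ) (G : Graph n) (H : Graph m) (M : Matrix n m) →
    Nonneg M →
    DoublyStochastic (M · (M ᵀ)) →
    DoublyStochastic ((M ᵀ) · M) →
    (∀ i j → (adjMatrix G · M) i j ≡ (M · adjMatrix H) i j) →
    IsBipartite (ZAdj M)
    × (∀ k → NumClasses (Reach (M · (M ᵀ))) k → NumClasses (ZConn M) k)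
    × (∀ v → ∃[ a ] ∃[ b ]
          ((∀ a' → ZConn M v (inj₁ a') ⇔ Reach (M · (M ᵀ)) a a')
           × (∀ b' → ZConn M v (inj₂ b') ⇔ Reach ((M ᵀ) · M) b b')))
    × (∀ a → (∃[ v ] (∀ a' → ZConn M v (inj₁ a') ⇔ Reach (M · (M ᵀ)) a a'))
             × (∀ v w → (∀ a' → ZConn M v (inj₁ a') ⇔ Reach (M · (M ᵀ)) a a')
                      → (∀ a' → ZConn M w (inj₁ a') ⇔ Reach (M · (M ᵀ)) a a')
                      → ZConn M v w))
    × (∀ b → (∃[ v ] (∀ b' → ZConn M v (inj₂ b') ⇔ Reach ((M ᵀ) · M) b b'))
             × (∀ v w → (∀ b' → ZConn M v (inj₂ b') ⇔ Reach ((M ᵀ) · M) b b')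
                      → (∀ b' → ZConn M w (inj₂ b') ⇔ Reach ((M ᵀ) · M) b b')
                      → ZConn M v w))
corollary9 R n m G H M M≥0 MMᵀ-ds MᵀM-ds _ =
  ZAdj-bipartite M , ZConn-numClasses , component-cells ,
  (λ a → (inj₁ a , ZConn⇔Reachᴳ a) ,
         λ v w v-cell w-cell → same-component M (from (v-cell a) (Reach-refl _ a)) (from (w-cell a) (Reach-refl _ a))) ,
  (λ b → (inj₂ b , ZConn⇔Reachᴴ b) ,
         λ v w v-cell w-cell → same-component M (from (v-cell b) (Reach-refl _ b)) (from (w-cell b) (Reach-refl _ b)))
  where
  open OrderedFieldProperties R
  open Components M M≥0 MMᵀ-ds MᵀM-ds
  open Equivalence
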